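{- For any base $\mathcal{B}$, atom $a$, and finite sets of atoms $P$ and $Q$, the following are equivalent: (1) $P, Q \vdash_{\mathcal{B}} a$; (2) for all bases $\mathcal{C} \supseteq \mathcal{B}$, if $Q \vdash_{\mathcal{C}} p$ for all $p \in P$, then $Q \vdash_{\mathcal{C}} a$; (3) $Q \vdash_{\mathcal{B}'} a$, where $\mathcal{B}' = \mathcal{B} \cup \{(\Rightarrow p) \mid p \in P\}$.
   Context: Fix a set $\mathrm{At}$ of atoms. An atomic rule has the form $((P_1 \Rightarrow a_1), \dots, (P_n \Rightarrow a_n) \Rightarrow b)$ with $n \ge 0$, where $a_1,\dots,a_n,b$ are atoms and each $P_i$ is a (possibly empty) finite set of atoms; $(\Rightarrow p)$ denotes the rule with $n=0$ and conclusion $p$. A base is a set of atomic rules; bases are ordered by set inclusion. For a base $\mathcal{B}$, the derivability relation $P \vdash_{\mathcal{B}} a$ (finite set of atoms $P$, atom $a$) is defined inductively by: (Ref) $P, a \vdash_{\mathcal{B}} a$; (App) for any rule $((P_1 \Rightarrow a_1),\dots,(P_n \Rightarrow a_n) \Rightarrow b) \in \mathcal{B}$ and finite set of atoms $Q$, if $Q, P_i \vdash_{\mathcal{B}} a_i$ for all $i$, then $Q \vdash_{\mathcal{B}} b$. Commas denote union. -}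

module Defs where

open import Level using (0ℓ)
open import Data.List using (List; []; _++_)
open import Data.List.Membership.Propositional using (_∈_)
open import Data.List.Relation.Unary.All using (All)
open import Data.Product using (_×_; _,_; proj₁; proj₂; ∃-syntax)
open import Relation.Binary.PropositionalEquality using (_≡_)
open import Relation.Unary using (Pred; _⊆_; _∪_)

-- Finite sets of atoms are represented by lists (only membership matters);
-- "commas denote union" is list concatenation _++_.
module Base (At : Set) where

  FinSet : Set
  FinSet = List At

  record Rule : Set where
    constructor _⇛_
    field
      premises   : List (FinSet × At)
      conclusion : At

  axiom : At → Rule
  axiom p = [] ⇛ p

  BaseSet : Set₁
  BaseSet = Pred Rule 0ℓ

  data _⊢[_]_ : FinSet → BaseSet → At → Set₁ where
    ref : ∀ {B P a} → a ∈ P → P ⊢[ B ] a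
    app : ∀ {B Q} (prems : List (FinSet × At)) (b : At) →
          B (prems ⇛ b) →
          All (λ Pa → (Q ++ proj₁ Pa) ⊢[ B ] proj₂ Pa) prems →
          Q ⊢[ B ] b

  extendWith : BaseSet → FinSet → BaseSet
  extendWith B P = B ∪ (λ r → ∃[ p ] (p ∈ P × r ≡ axiom p))

-- (1) ⇒ (2): lift the derivation to C, then cut each hypothesis p ∈ P
-- against its derivation from Q.  (2) ⇒ (3): take C = B ∪ {(⇒ p) | p ∈ P},
-- where each p ∈ P is derivable from Q by its own axiom.  (3) ⇒ (1): weaken
-- the context to P, Q; as P then stays in every context of the derivation,
-- each axiom (⇒ p) can be replaced by Ref.
{-# OPTIONS --safe #-}
module Submission where

open import Defs
open import Function using (_∘_)
open import Data.List using (List; _++_)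
open import Data.List.Membership.Propositional using (_∈_)
open import Data.List.Membership.Propositional.Properties using (∈-++⁻)
open import Data.List.Relation.Binary.Subset.Propositional using () renaming (_⊆_ to _⊆ᴸ_)
open import Data.List.Relation.Binary.Subset.Propositional.Properties using (⊆-refl; ⊆-trans; xs⊆xs++ys; xs⊆ys++xs; ++⁺ˡ)
open import Data.List.Relation.Unary.All using (All; []; _∷_)
open import Data.Product using (_×_; _,_; proj₁; proj₂)
open import Data.Sum using ([_,_]′; inj₁; inj₂)
open import Relation.Binary.PropositionalEquality using (refl)
open import Relation.Unary using (_⊆_)

module Derivability (At : Set) where
  open Base At

  private variable
    B C : BaseSet
    P Q R S : FinSet
    a : At
    prems : List (FinSet × At)

  infix 4 _⊢[_]*_ _⊢[_]all_

  _⊢[_]*_ : FinSet → BaseSet → FinSet → Set₁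
  Q ⊢[ C ]* R = ∀ x → x ∈ R → Q ⊢[ C ] x

  _⊢[_]all_ : FinSet → BaseSet → List (FinSet × At) → Set₁
  Q ⊢[ B ]all prems = All (λ Pa → (Q ++ proj₁ Pa) ⊢[ B ] proj₂ Pa) prems

  ⊢-weaken : R ⊆ᴸ S → R ⊢[ B ] a → S ⊢[ B ] a
  ⊢-weaken-all : R ⊆ᴸ S → R ⊢[ B ]all prems → S ⊢[ B ]all prems
  ⊢-weaken R⊆S (ref a∈R) = ref (R⊆S a∈R)
  ⊢-weaken R⊆S (app prems b r ds) = app prems b r (⊢-weaken-all R⊆S ds)
  ⊢-weaken-all R⊆S [] = []
  ⊢-weaken-all R⊆S (d ∷ ds) = ⊢-weaken (++⁺ˡ _ R⊆S) d ∷ ⊢-weaken-all R⊆S ds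

  ⊢-mono : B ⊆ C → R ⊢[ B ] a → R ⊢[ C ] a
  ⊢-mono-all : B ⊆ C → R ⊢[ B ]all prems → R ⊢[ C ]all prems
  ⊢-mono B⊆C (ref a∈R) = ref a∈R
  ⊢-mono B⊆C (app prems b r ds) = app prems b (B⊆C r) (⊢-mono-all B⊆C ds)
  ⊢-mono-all B⊆C [] = []
  ⊢-mono-all B⊆C (d ∷ ds) = ⊢-mono B⊆C d ∷ ⊢-mono-all B⊆C ds

  ⊆⇒⊢* : R ⊆ᴸ Q → Q ⊢[ C ]* R
  ⊆⇒⊢* R⊆Q _ = ref ∘ R⊆Q

  ⊢*-++ : Q ⊢[ C ]* R → Q ⊢[ C ]* S → Q ⊢[ C ]* (R ++ S)
  ⊢*-++ {R = R} σ τ x x∈R++S = [ σ x , τ x ]′ (∈-++⁻ R x∈R++S)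

  ⊢*-++ʳ : Q ⊢[ C ]* R → (Q ++ S) ⊢[ C ]* (R ++ S)
  ⊢*-++ʳ {Q = Q} {S = S} σ =
    ⊢*-++ (λ x → ⊢-weaken (xs⊆xs++ys Q S) ∘ σ x) (⊆⇒⊢* (xs⊆ys++xs S Q))

  ⊢-cut : Q ⊢[ C ]* R → R ⊢[ C ] a → Q ⊢[ C ] a
  ⊢-cut-all : Q ⊢[ C ]* R → R ⊢[ C ]all prems → Q ⊢[ C ]all prems
  ⊢-cut σ (ref a∈R) = σ _ a∈R
  ⊢-cut σ (app prems b r ds) = app prems b r (⊢-cut-all σ ds)
  ⊢-cut-all σ [] = []
  ⊢-cut-all σ (d ∷ ds) = ⊢-cut (⊢*-++ʳ σ) d ∷ ⊢-cut-all σ ds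

  ⊢-axiom : Q ⊢[ extendWith B P ]* P
  ⊢-axiom p p∈P = app _ p (inj₂ (p , p∈P , refl)) []

  ⊢-extendWith-elim : P ⊆ᴸ S → S ⊢[ extendWith B P ] a → S ⊢[ B ] a
  ⊢-extendWith-elim-all : P ⊆ᴸ S → S ⊢[ extendWith B P ]all prems →
                          S ⊢[ B ]all prems
  ⊢-extendWith-elim P⊆S (ref a∈S) = ref a∈S
  ⊢-extendWith-elim P⊆S (app prems b (inj₁ r) ds) =
    app prems b r (⊢-extendWith-elim-all P⊆S ds)
  ⊢-extendWith-elim P⊆S (app _ b (inj₂ (_ , b∈P , refl)) _) = ref (P⊆S b∈P)
  ⊢-extendWith-elim-all P⊆S [] = []
  ⊢-extendWith-elim-all P⊆S (d ∷ ds) =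
    ⊢-extendWith-elim (⊆-trans P⊆S (xs⊆xs++ys _ _)) d
      ∷ ⊢-extendWith-elim-all P⊆S ds

lemma3 : (At : Set) → let open Base At in
    (B : BaseSet) (a : At) (P Q : FinSet) →
      ((P ++ Q) ⊢[ B ] a →
        ((C : BaseSet) → B ⊆ C → (∀ p → p ∈ P → Q ⊢[ C ] p) → Q ⊢[ C ] a))
    × (((C : BaseSet) → B ⊆ C → (∀ p → p ∈ P → Q ⊢[ C ] p) → Q ⊢[ C ] a) →
        Q ⊢[ extendWith B P ] a)
    × (Q ⊢[ extendWith B P ] a → (P ++ Q) ⊢[ B ] a)
lemma3 At B a P Q =
    (λ d C B⊆C σ → ⊢-cut (⊢*-++ σ (⊆⇒⊢* ⊆-refl)) (⊢-mono B⊆C d))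
  , (λ valid → valid (extendWith B P) inj₁ ⊢-axiom)
  , ⊢-extendWith-elim (xs⊆xs++ys P Q) ∘ ⊢-weaken (xs⊆ys++xs Q P)
  where
  open Base At
  open Derivability At
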